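{- If a graph $G$ has a Hamiltonian path and $\delta(G)\ge 3$, then $G$ has the strong parity property.
   Context: Graphs may have loops and multiple edges; the degree $\deg_G(v)$ counts each loop twice. A factor of $G$ is a spanning subgraph $H$ of $G$ with minimum degree $\delta(H)\ge 1$. For a set $X\subseteq V(G)$ of even cardinality, an $X$-parity-factor of $G$ is a factor $H$ of $G$ such that $\deg_H(v)$ is odd for every $v\in X$ and $\deg_H(v)$ is even for every $v\in V(G)\setminus X$. A graph $G$ has the strong parity property if for every subset $X\subseteq V(G)$ of even cardinality (including $X=\emptyset$), $G$ has an $X$-parity-factor. -}

module Defs where

open import Data.Nat using (ℕ; zero; suc; _+_; _*_; _≥_; _<_)
open import Data.Fin using (Fin; zero; suc; toℕ)
open import Data.Bool using (Bool; true; false; if_then_else_)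
open import Data.Product using (Σ; ∃; _×_; _,_; proj₁; proj₂)
open import Data.Sum using (_⊎_)
open import Relation.Nullary using (does)
open import Data.Fin using (_≟_)
open import Relation.Binary.PropositionalEquality using (_≡_)

sumFin : (k : ℕ) → (Fin k → ℕ) → ℕ
sumFin zero    f = 0
sumFin (suc k) f = f zero + sumFin k (λ i → f (suc i))

-- A finite multigraph (loops and parallel edges allowed) with n vertices
-- Fin n and m edges Fin m; edge e joins the two (unordered) ends
-- proj₁ (ends e) and proj₂ (ends e); it is a loop when they coincide.
record Graph : Set where
  field
    n    : ℕ
    m    : ℕ
    ends : Fin m → Fin n × Fin n
open Graph public

Vertex : Graph → Set
Vertex G = Fin (n G)

Edge : Graph → Set
Edge G = Fin (m G)

-- number of ends of edge e at vertex v (0, 1 or 2; a loop at v gives 2)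
incid : (G : Graph) → Edge G → Vertex G → ℕ
incid G e v =
  (if does (proj₁ (ends G e) ≟ v) then 1 else 0) +
  (if does (proj₂ (ends G e) ≟ v) then 1 else 0)

deg : (G : Graph) → Vertex G → ℕ
deg G v = sumFin (m G) (λ e → incid G e v)

-- spanning subgraphs of G are given by the set of edges they keep
SpanningSubgraph : Graph → Set
SpanningSubgraph G = Edge G → Bool

degSub : (G : Graph) → SpanningSubgraph G → Vertex G → ℕ
degSub G H v = sumFin (m G) (λ e → if H e then incid G e v else 0)

MinDegAtLeast : (G : Graph) → ℕ → Set
MinDegAtLeast G k = ∀ v → deg G v ≥ k

IsFactor : (G : Graph) → SpanningSubgraph G → Set
IsFactor G H = ∀ v → degSub G H v ≥ 1

Even Odd : ℕ → Set
Even d = ∃ λ k → d ≡ 2 * k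
Odd  d = ∃ λ k → d ≡ suc (2 * k)

VSubset : Graph → Set
VSubset G = Vertex G → Bool

card : (G : Graph) → VSubset G → ℕ
card G X = sumFin (n G) (λ v → if X v then 1 else 0)

IsParityFactor : (G : Graph) → VSubset G → SpanningSubgraph G → Set
IsParityFactor G X H =
  IsFactor G H ×
  (∀ v → X v ≡ true  → Odd  (degSub G H v)) ×
  (∀ v → X v ≡ false → Even (degSub G H v))

StrongParityProperty : Graph → Set
StrongParityProperty G =
  ∀ (X : VSubset G) → Even (card G X) → ∃ λ H → IsParityFactor G X H

Adjacent : (G : Graph) → Vertex G → Vertex G → Set
Adjacent G u v = ∃ λ e → (ends G e ≡ (u , v)) ⊎ (ends G e ≡ (v , u))

IsBijection : ∀ {k} → (Fin k → Fin k) → Set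
IsBijection {k} p =
  (∀ i j → p i ≡ p j → i ≡ j) × (∀ v → ∃ λ i → p i ≡ v)

HasHamiltonianPath : Graph → Set
HasHamiltonianPath G =
  ∃ λ (p : Fin (n G) → Vertex G) →
    IsBijection p ×
    (∀ (i j : Fin (n G)) → toℕ j ≡ suc (toℕ i) → Adjacent G (p i) (p j))

module Submission where

-- Given an even set X, let T be the set of vertices whose degree has
-- the wrong parity, i.e. deg v + [v ∈ X] is odd.  By the handshake lemma T is
-- even.  On a path every even vertex set T is the odd-degree set of some set
-- of path edges (a "T-join"), found greedily from one end of the path.  Pushing
-- this edge set along the Hamiltonian path gives a spanning subgraph S of G
-- whose degrees have the parities of T and are at most 2 (every vertex meets at
-- most two path edges).  Deleting S from G flips exactly the parities at T, so
-- the remaining subgraph has odd degree precisely on X, and since δ(G) ≥ 3 > 2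
-- no vertex becomes isolated: it is an X-parity-factor.

open import Defs
open import Data.Nat using (ℕ; zero; suc; pred; parity; _+_; _*_; _≤_; _<_; z≤n; s≤s)
open import Data.Nat.Properties
  using (+-assoc; +-comm; +-identityʳ; *-identityˡ; *-comm; *-distribʳ-+; ≤-refl; ≤-trans; ≤-reflexive;
         +-mono-≤; m≤m+n; +-cancelʳ-≤; *-suc; +-commutativeSemigroup)
open import Algebra.Properties.CommutativeSemigroup +-commutativeSemigroup
  using (interchange)
open import Data.Parity.Base as ℙ using (Parity; 0ℙ; 1ℙ)
open import Data.Parity.Properties using (+-homo-+; *-homo-*)
open import Data.Fin using (Fin; zero; suc; inject₁; _≟_)
open import Data.Fin.Properties using (toℕ-inject₁)
open import Data.Bool using (Bool; true; false; not; if_then_else_)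
open import Data.Vec.Functional using (_∷_)
open import Data.Product using (∃; _×_; _,_; proj₁; proj₂)
open import Data.Sum using (inj₁; inj₂)
open import Function.Bundles using (mk⇔)
open import Relation.Nullary using (does)
open import Relation.Nullary.Decidable using (does-⇔)
open import Relation.Binary.PropositionalEquality
  using (_≡_; refl; sym; trans; cong; cong₂; subst; module ≡-Reasoning)

χ : Bool → ℕ
χ b = if b then 1 else 0

χ-* : ∀ b x → χ b * x ≡ (if b then x else 0)
χ-* true  x = +-identityʳ x
χ-* false x = refl

select-≤ : ∀ b x → (if b then x else 0) ≤ x
select-≤ true  x = ≤-refl
select-≤ false x = z≤n

select-zero : ∀ b → (if b then 0 else 0) ≡ 0
select-zero true  = refl
select-zero false = refl

odd? : Parity → Bool
odd? 0ℙ = false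
odd? 1ℙ = true

parity-χ-odd? : ∀ p → parity (χ (odd? p)) ≡ p
parity-χ-odd? 0ℙ = refl
parity-χ-odd? 1ℙ = refl

parity-even : ∀ {d} → Even d → parity d ≡ 0ℙ
parity-even (c , refl) = *-homo-* 2 c
even-parity : ∀ d → parity d ≡ 0ℙ → Even d
even-parity zero          _  = 0 , refl
even-parity (suc zero)    ()
even-parity (suc (suc d)) h  =
  let (c , d≡2c) = even-parity d h
  in suc c , trans (cong (λ x → suc (suc x)) d≡2c) (sym (*-suc 2 c))

odd-parity : ∀ d → parity d ≡ 1ℙ → Odd d
odd-parity zero          ()
odd-parity (suc zero)    _  = 0 , refl
odd-parity (suc (suc d)) h  =
  let (c , d≡2c+1) = odd-parity d h
  in suc c , trans (cong (λ x → suc (suc x)) d≡2c+1) (cong suc (sym (*-suc 2 c)))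

parity-cancel : ∀ a b c → a ℙ.+ (b ℙ.+ c) ≡ b → a ≡ c
parity-cancel 0ℙ 0ℙ 0ℙ _ = refl
parity-cancel 0ℙ 1ℙ 1ℙ ()
parity-cancel 0ℙ 0ℙ 1ℙ ()
parity-cancel 0ℙ 1ℙ 0ℙ _ = refl
parity-cancel 1ℙ 0ℙ 0ℙ ()
parity-cancel 1ℙ 0ℙ 1ℙ _ = refl
parity-cancel 1ℙ 1ℙ 0ℙ ()
parity-cancel 1ℙ 1ℙ 1ℙ _ = refl

parity-+-self : ∀ p q → p ℙ.+ (p ℙ.+ q) ≡ q
parity-+-self 0ℙ q  = refl
parity-+-self 1ℙ 0ℙ = refl
parity-+-self 1ℙ 1ℙ = refl

parity-select : ∀ c x → parity (if odd? (parity c) then x else 0) ≡ parity (c * x)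
parity-select c x rewrite *-homo-* c x with parity c
... | 0ℙ = refl
... | 1ℙ = refl

select-odd-≤ : ∀ c x → (if odd? (parity c) then x else 0) ≤ c * x
select-odd-≤ zero    x = z≤n
select-odd-≤ (suc c) x = ≤-trans (select-≤ (odd? (parity (suc c))) x) (m≤m+n x (c * x))

sum-cong : ∀ k {f g : Fin k → ℕ} → (∀ i → f i ≡ g i) → sumFin k f ≡ sumFin k g
sum-cong zero    _ = refl
sum-cong (suc k) f≡g = cong₂ _+_ (f≡g zero) (sum-cong k (λ i → f≡g (suc i)))

sum-mono : ∀ k {f g : Fin k → ℕ} → (∀ i → f i ≤ g i) → sumFin k f ≤ sumFin k g
sum-mono zero    _ = z≤n
sum-mono (suc k) f≤g = +-mono-≤ (f≤g zero) (sum-mono k (λ i → f≤g (suc i)))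

sum-parity-cong : ∀ k {f g : Fin k → ℕ} → (∀ i → parity (f i) ≡ parity (g i)) →
                  parity (sumFin k f) ≡ parity (sumFin k g)
sum-parity-cong zero    _ = refl
sum-parity-cong (suc k) {f} {g} f≈g = begin
  parity (sumFin (suc k) f)                              ≡⟨ +-homo-+ (f zero) _ ⟩
  parity (f zero) ℙ.+ parity (sumFin k (λ i → f (suc i))) ≡⟨ cong₂ ℙ._+_ (f≈g zero) (sum-parity-cong k (λ i → f≈g (suc i))) ⟩
  parity (g zero) ℙ.+ parity (sumFin k (λ i → g (suc i))) ≡⟨ +-homo-+ (g zero) _ ⟨
  parity (sumFin (suc k) g)                              ∎
  where open ≡-Reasoning

sum-const : ∀ k x → sumFin k (λ _ → x) ≡ k * x
sum-const zero    x = refl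
sum-const (suc k) x = cong (x +_) (sum-const k x)

sum-+ : ∀ k (f g : Fin k → ℕ) → sumFin k (λ i → f i + g i) ≡ sumFin k f + sumFin k g
sum-+ zero    f g = refl
sum-+ (suc k) f g = trans (cong (f zero + g zero +_) (sum-+ k _ _)) (interchange (f zero) (g zero) _ _)

sum-zero : ∀ k → sumFin k (λ _ → 0) ≡ 0
sum-zero zero    = refl
sum-zero (suc k) = sum-zero k

sum-swap : ∀ k l (f : Fin k → Fin l → ℕ) →
           sumFin k (λ i → sumFin l (f i)) ≡ sumFin l (λ j → sumFin k (λ i → f i j))
sum-swap zero    l f = sym (sum-zero l)
sum-swap (suc k) l f = trans (cong (sumFin l (f zero) +_) (sum-swap k l (λ i → f (suc i))))
                             (sym (sum-+ l (f zero) (λ j → sumFin k (λ i → f (suc i) j))))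

sum-*ʳ : ∀ k (f : Fin k → ℕ) x → sumFin k f * x ≡ sumFin k (λ i → f i * x)
sum-*ʳ zero    f x = refl
sum-*ʳ (suc k) f x = trans (*-distribʳ-+ x (f zero) _) (cong (f zero * x +_) (sum-*ʳ k (λ i → f (suc i)) x))

sum-at : ∀ k (a : Fin k) (f : Fin k → ℕ) → sumFin k (λ e → if does (a ≟ e) then f e else 0) ≡ f a
sum-at (suc k) zero    f = trans (cong (f zero +_) (sum-zero k)) (+-identityʳ (f zero))
sum-at (suc k) (suc a) f = sum-at k a (λ e → f (suc e))

count-at : ∀ k (a : Fin k) → sumFin k (λ j → χ (does (j ≟ a))) ≡ 1
count-at (suc k) zero    = cong suc (sum-zero k)
count-at (suc k) (suc a) = count-at k a

does-injective : ∀ {k l} (p : Fin k → Fin l) → (∀ i j → p i ≡ p j → i ≡ j) →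
                 ∀ a b → does (p a ≟ p b) ≡ does (a ≟ b)
does-injective p inj a b = does-⇔ (mk⇔ (inj a b) (cong p)) (p a ≟ p b) (a ≟ b)

sum-reindex : ∀ k (p : Fin k → Fin k) → IsBijection p →
              (f : Fin k → ℕ) → sumFin k (λ j → f (p j)) ≡ sumFin k f
sum-reindex k p (inj , surj) f = begin
  sumFin k (λ j → f (p j))
    ≡⟨ sum-cong k (λ j → sym (sum-at k (p j) f)) ⟩
  sumFin k (λ j → sumFin k (λ v → if does (p j ≟ v) then f v else 0))
    ≡⟨ sum-swap k k _ ⟩
  sumFin k (λ v → sumFin k (λ j → if does (p j ≟ v) then f v else 0))
    ≡⟨ sum-cong k fibre ⟩
  sumFin k f ∎
  where
  open ≡-Reasoning
  fibre-size : ∀ v → sumFin k (λ j → χ (does (p j ≟ v))) ≡ 1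
  fibre-size v = let (a , pa≡v) = surj v in
    subst (λ w → sumFin k (λ j → χ (does (p j ≟ w))) ≡ 1) pa≡v
      (trans (sum-cong k (λ j → cong χ (does-injective p inj j a))) (count-at k a))
  fibre : ∀ v → sumFin k (λ j → if does (p j ≟ v) then f v else 0) ≡ f v
  fibre v = begin
    sumFin k (λ j → if does (p j ≟ v) then f v else 0) ≡⟨ sum-cong k (λ j → sym (χ-* _ (f v))) ⟩
    sumFin k (λ j → χ (does (p j ≟ v)) * f v)          ≡⟨ sum-*ʳ k _ (f v) ⟨
    sumFin k (λ j → χ (does (p j ≟ v))) * f v          ≡⟨ cong (_* f v) (fibre-size v) ⟩
    1 * f v                                             ≡⟨ *-identityˡ (f v) ⟩
    f v                                                 ∎

sum-fibres : ∀ k l (g : Fin k → Fin l) (r : Fin k → Bool) (x : Fin l → ℕ) →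
             sumFin l (λ e → sumFin k (λ i → if r i then χ (does (g i ≟ e)) else 0) * x e)
             ≡ sumFin k (λ i → if r i then x (g i) else 0)
sum-fibres k l g r x = begin
  sumFin l (λ e → sumFin k (λ i → c i e) * x e)   ≡⟨ sum-cong l (λ e → sum-*ʳ k (λ i → c i e) (x e)) ⟩
  sumFin l (λ e → sumFin k (λ i → c i e * x e))   ≡⟨ sum-swap k l (λ i e → c i e * x e) ⟨
  sumFin k (λ i → sumFin l (λ e → c i e * x e))   ≡⟨ sum-cong k (λ i → selected (r i) (g i)) ⟩
  sumFin k (λ i → if r i then x (g i) else 0)      ∎
  where
  open ≡-Reasoning
  c : Fin k → Fin l → ℕ
  c i e = if r i then χ (does (g i ≟ e)) else 0
  selected : ∀ b a → sumFin l (λ e → (if b then χ (does (a ≟ e)) else 0) * x e) ≡ (if b then x a else 0)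
  selected true  a = trans (sum-cong l (λ e → χ-* (does (a ≟ e)) (x e))) (sum-at l a x)
  selected false a = sum-zero l

handshake : (G : Graph) → sumFin (n G) (deg G) ≡ 2 * m G
handshake G = begin
  sumFin (n G) (λ v → sumFin (m G) (λ e → incid G e v)) ≡⟨ sum-swap (n G) (m G) (λ v e → incid G e v) ⟩
  sumFin (m G) (λ e → sumFin (n G) (incid G e))         ≡⟨ sum-cong (m G) two-ends ⟩
  sumFin (m G) (λ _ → 2)                                ≡⟨ sum-const (m G) 2 ⟩
  m G * 2                                               ≡⟨ *-comm (m G) 2 ⟩
  2 * m G                                               ∎
  where
  open ≡-Reasoning
  two-ends : ∀ e → sumFin (n G) (incid G e) ≡ 2
  two-ends e = trans (sum-+ (n G) _ _)
    (cong₂ _+_ (sum-at (n G) (proj₁ (ends G e)) (λ _ → 1)) (sum-at (n G) (proj₂ (ends G e)) (λ _ → 1)))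

degSub-≤-deg : (G : Graph) (S : SpanningSubgraph G) → ∀ v → degSub G S v ≤ deg G v
degSub-≤-deg G S v = sum-mono (m G) (λ e → select-≤ (S e) (incid G e v))

delete-split : (G : Graph) (S : SpanningSubgraph G) →
               ∀ v → degSub G (λ e → not (S e)) v + degSub G S v ≡ deg G v
delete-split G S v = trans (sym (sum-+ (m G) _ _)) (sum-cong (m G) (λ e → complementary (S e) (incid G e v)))
  where
  complementary : ∀ b x → (if not b then x else 0) + (if b then x else 0) ≡ x
  complementary true  x = refl
  complementary false x = +-identityʳ x

-- Demands d : V → ℕ prescribe degree parities; S is a d-join of G when
-- deg_S v ≡ d v (mod 2) at every vertex (a T-join for T = {v | d v odd}).
IsJoin : (G : Graph) → (Vertex G → ℕ) → SpanningSubgraph G → Set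
IsJoin G d S = ∀ v → parity (degSub G S v) ≡ parity (d v)

-- The parity defect of X: v must change degree parity iff deg_G v + [v ∈ X] is odd.
defect : (G : Graph) → VSubset G → Vertex G → ℕ
defect G X v = deg G v + χ (X v)

defect-even : (G : Graph) (X : VSubset G) → Even (card G X) → parity (sumFin (n G) (defect G X)) ≡ 0ℙ
defect-even G X X-even = begin
  parity (sumFin (n G) (defect G X))                          ≡⟨ cong parity (sum-+ (n G) (deg G) (λ v → χ (X v))) ⟩
  parity (sumFin (n G) (deg G) + card G X)                    ≡⟨ +-homo-+ (sumFin (n G) (deg G)) (card G X) ⟩
  parity (sumFin (n G) (deg G)) ℙ.+ parity (card G X)         ≡⟨ cong₂ ℙ._+_ degrees-even (parity-even X-even) ⟩
  0ℙ                                                          ∎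
  where
  open ≡-Reasoning
  degrees-even : parity (sumFin (n G) (deg G)) ≡ 0ℙ
  degrees-even = trans (cong parity (handshake G)) (parity-even (m G , refl))

delete-join : (G : Graph) (X : VSubset G) (S : SpanningSubgraph G) →
              IsJoin G (defect G X) S →
              (∀ v → degSub G S v < deg G v) →
              IsParityFactor G X (λ e → not (S e))
delete-join G X S S-parity S-small =
    factor
  , (λ v Xv → odd-parity _ (trans (parity-rest v) (cong (λ b → parity (χ b)) Xv)))
  , (λ v Xv → even-parity _ (trans (parity-rest v) (cong (λ b → parity (χ b)) Xv)))
  where
  rest : Vertex G → ℕ
  rest = degSub G (λ e → not (S e))
  parity-rest : ∀ v → parity (rest v) ≡ parity (χ (X v))
  parity-rest v = parity-cancel _ (parity (deg G v)) _ (begin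
    parity (rest v) ℙ.+ (parity (deg G v) ℙ.+ parity (χ (X v))) ≡⟨ cong (parity (rest v) ℙ.+_) (+-homo-+ (deg G v) _) ⟨
    parity (rest v) ℙ.+ parity (deg G v + χ (X v))              ≡⟨ cong (parity (rest v) ℙ.+_) (S-parity v) ⟨
    parity (rest v) ℙ.+ parity (degSub G S v)                   ≡⟨ +-homo-+ (rest v) _ ⟨
    parity (rest v + degSub G S v)                              ≡⟨ cong parity (delete-split G S v) ⟩
    parity (deg G v)                                            ∎)
    where open ≡-Reasoning
  factor : IsFactor G (λ e → not (S e))
  factor v = +-cancelʳ-≤ (degSub G S v) 1 (rest v)
    (subst (suc (degSub G S v) ≤_) (sym (delete-split G S v)) (S-small v))

-- The path graph on k vertices:  0 — 1 — … — (k-1),  edge i joining i and i+1.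
pathEnds : ∀ k → Fin (pred k) → Fin k × Fin k
pathEnds zero    ()
pathEnds (suc k) i = inject₁ i , suc i

path : ℕ → Graph
path k = record { n = k ; m = pred k ; ends = pathEnds k }

path-degree-start : ∀ k → deg (path (suc k)) zero ≤ 1
path-degree-start zero    = z≤n
path-degree-start (suc k) = s≤s (≤-reflexive (sum-zero k))

path-degree : ∀ k (j : Fin k) → deg (path k) j ≤ 2
path-degree (suc zero)    zero          = z≤n
path-degree (suc (suc k)) zero          = ≤-trans (path-degree-start (suc k)) (s≤s z≤n)
path-degree (suc (suc k)) (suc zero)    = s≤s (path-degree-start k)
path-degree (suc (suc k)) (suc (suc j)) = path-degree (suc k) (suc j)

-- Vertex 0 of a path passes its demand on to vertex 1.
pass-demand : ∀ k → (Fin (suc (suc k)) → ℕ) → Fin (suc k) → ℕ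
pass-demand k d = (d zero + d (suc zero)) ∷ (λ j → d (suc (suc j)))

extend-join : ∀ k (d : Fin (suc (suc k)) → ℕ) (r : SpanningSubgraph (path (suc k))) →
              IsJoin (path (suc k)) (pass-demand k d) r →
              IsJoin (path (suc (suc k))) d (odd? (parity (d zero)) ∷ r)
extend-join k d r r-join zero = begin
  parity (χ first + sumFin k (λ i → if r i then 0 else 0))
    ≡⟨ cong (λ s → parity (χ first + s)) (trans (sum-cong k (λ i → select-zero (r i))) (sum-zero k)) ⟩
  parity (χ first + 0)  ≡⟨ cong parity (+-identityʳ (χ first)) ⟩
  parity (χ first)      ≡⟨ parity-χ-odd? (parity (d zero)) ⟩
  parity (d zero)       ∎
  where
  open ≡-Reasoning
  first : Bool
  first = odd? (parity (d zero))
extend-join k d r r-join (suc zero) = begin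
  parity (χ first + degSub (path (suc k)) r zero)
    ≡⟨ +-homo-+ (χ first) _ ⟩
  parity (χ first) ℙ.+ parity (degSub (path (suc k)) r zero)
    ≡⟨ cong₂ ℙ._+_ (parity-χ-odd? (parity (d zero))) (r-join zero) ⟩
  parity (d zero) ℙ.+ parity (d zero + d (suc zero))
    ≡⟨ cong (parity (d zero) ℙ.+_) (+-homo-+ (d zero) (d (suc zero))) ⟩
  parity (d zero) ℙ.+ (parity (d zero) ℙ.+ parity (d (suc zero)))
    ≡⟨ parity-+-self (parity (d zero)) _ ⟩
  parity (d (suc zero)) ∎
  where
  open ≡-Reasoning
  first : Bool
  first = odd? (parity (d zero))
extend-join k d r r-join (suc (suc j)) =
  trans (cong (λ x → parity (x + degSub (path (suc k)) r (suc j))) (select-zero (odd? (parity (d zero)))))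
        (r-join (suc j))

path-join : ∀ k (d : Fin k → ℕ) → parity (sumFin k d) ≡ 0ℙ →
            ∃ λ (r : SpanningSubgraph (path k)) → IsJoin (path k) d r
path-join zero          d _    = (λ ()) , (λ ())
path-join (suc zero)    d even = (λ ()) , λ { zero → sym (trans (cong parity (sym (+-identityʳ (d zero)))) even) }
path-join (suc (suc k)) d even =
  let (r , r-join) = path-join (suc k) (pass-demand k d) (trans (cong parity (+-assoc (d zero) (d (suc zero)) _)) even)
  in odd? (parity (d zero)) ∷ r , extend-join k d r r-join

-- A spanning path of G lists the vertices of G, each once,
-- and for consecutive vertices chooses an edge of G joining them; equivalently
-- it is a copy of path (n G) in G with the same incidences.
record SpanningPath (G : Graph) : Set where
  field
    vertex           : Fin (n G) → Vertex G
    vertex-bijective : IsBijection vertex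
    edge             : Edge (path (n G)) → Edge G
    incid-preserved  : ∀ i j → incid G (edge i) (vertex j) ≡ incid (path (n G)) i j

incid-joining : (G : Graph) {k : ℕ} (p : Fin k → Vertex G) → (∀ i j → p i ≡ p j → i ≡ j) →
                ∀ {e a b} → ends G e ≡ (p a , p b) →
                ∀ j → incid G e (p j) ≡ χ (does (a ≟ j)) + χ (does (b ≟ j))
incid-joining G p inj {a = a} {b} ends≡ j = begin
  incid G _ (p j)                                    ≡⟨ cong (λ ab → χ (does (proj₁ ab ≟ p j)) + χ (does (proj₂ ab ≟ p j))) ends≡ ⟩
  χ (does (p a ≟ p j)) + χ (does (p b ≟ p j))        ≡⟨ cong₂ _+_ (cong χ (does-injective p inj a j)) (cong χ (does-injective p inj b j)) ⟩
  χ (does (a ≟ j)) + χ (does (b ≟ j))                ∎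
  where open ≡-Reasoning

hamiltonian-spanningPath : (G : Graph) → HasHamiltonianPath G → SpanningPath G
hamiltonian-spanningPath record { n = zero } (p , p-bij , _) =
  record { vertex = p ; vertex-bijective = p-bij ; edge = λ () ; incid-preserved = λ () }
hamiltonian-spanningPath G@record { n = suc k } (p , p-bij@(p-inj , _) , adjacent) =
  record { vertex = p ; vertex-bijective = p-bij ; edge = λ i → proj₁ (step i) ; incid-preserved = preserved }
  where
  step : ∀ i → Adjacent G (p (inject₁ i)) (p (suc i))
  step i = adjacent (inject₁ i) (suc i) (cong suc (sym (toℕ-inject₁ i)))
  preserved : ∀ i j → incid G (proj₁ (step i)) (p j) ≡ incid (path (suc k)) i j
  preserved i j with proj₂ (step i)
  ... | inj₁ ends≡ = incid-joining G p p-inj ends≡ j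
  ... | inj₂ ends≡ = trans (incid-joining G p p-inj ends≡ j) (+-comm (χ (does (suc i ≟ j))) _)

module _ (G : Graph) (P : SpanningPath G) where
  open SpanningPath P

  multiplicity : SpanningSubgraph (path (n G)) → Edge G → ℕ
  multiplicity r e = sumFin (pred (n G)) (λ i → if r i then χ (does (edge i ≟ e)) else 0)

  push : SpanningSubgraph (path (n G)) → SpanningSubgraph G
  push r e = odd? (parity (multiplicity r e))

  weighted-degree : ∀ r j → sumFin (m G) (λ e → multiplicity r e * incid G e (vertex j)) ≡ degSub (path (n G)) r j
  weighted-degree r j =
    trans (sum-fibres (pred (n G)) (m G) edge r (λ e → incid G e (vertex j)))
          (sum-cong (pred (n G)) (λ i → cong (λ x → if r i then x else 0) (incid-preserved i j)))

  -- pushing preserves degree parities (an edge used twice cancels) ...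
  push-parity : ∀ r j → parity (degSub G (push r) (vertex j)) ≡ parity (degSub (path (n G)) r j)
  push-parity r j = trans (sum-parity-cong (m G) (λ e → parity-select (multiplicity r e) (incid G e (vertex j))))
                          (cong parity (weighted-degree r j))

  push-≤ : ∀ r j → degSub G (push r) (vertex j) ≤ degSub (path (n G)) r j
  push-≤ r j = ≤-trans (sum-mono (m G) (λ e → select-odd-≤ (multiplicity r e) (incid G e (vertex j))))
                       (≤-reflexive (weighted-degree r j))

  on-path : {Q : Vertex G → Set} → (∀ j → Q (vertex j)) → ∀ v → Q v
  on-path {Q} Q-path v = let (j , vj≡v) = proj₂ vertex-bijective v in subst Q vj≡v (Q-path j)

  spanning-path-join : (d : Vertex G → ℕ) → parity (sumFin (n G) d) ≡ 0ℙ →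
                       ∃ λ S → IsJoin G d S × (∀ v → degSub G S v ≤ 2)
  spanning-path-join d even =
      push r
    , on-path (λ j → trans (push-parity r j) (r-join j))
    , on-path (λ j → ≤-trans (push-≤ r j) (≤-trans (degSub-≤-deg (path (n G)) r j) (path-degree (n G) j)))
    where
    even-on-path : parity (sumFin (n G) (λ j → d (vertex j))) ≡ 0ℙ
    even-on-path = trans (cong parity (sum-reindex (n G) vertex vertex-bijective d)) even
    r : SpanningSubgraph (path (n G))
    r = proj₁ (path-join (n G) (λ j → d (vertex j)) even-on-path)
    r-join : IsJoin (path (n G)) (λ j → d (vertex j)) r
    r-join = proj₂ (path-join (n G) (λ j → d (vertex j)) even-on-path)

mainTheorem6 : (G : Graph) → HasHamiltonianPath G → MinDegAtLeast G 3 →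
    StrongParityProperty G
mainTheorem6 G hamiltonian δ≥3 X X-even =
  let (S , S-join , S-≤2) = spanning-path-join G (hamiltonian-spanningPath G hamiltonian)
                                               (defect G X) (defect-even G X X-even)
  in (λ e → not (S e)) , delete-join G X S S-join (λ v → ≤-trans (s≤s (S-≤2 v)) (δ≥3 v))
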